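{- For every integer $n$, let $c(n)$, $c_2^+(n)$, $c_4^+(n)$ denote the coefficients of $q^n$ in the $q$-expansions of $j(z)$, $j_2^+(z)$, $j_4^+(z)$ respectively. Then $$c(n)\equiv c_2^+(n)\equiv c_4^+(n)\pmod 2 .$$
   Context: Let $z$ lie in the upper half-plane and $q=e^{2\pi i z}$. The Dedekind eta function is $\eta(z)=q^{1/24}\prod_{n\ge1}(1-q^n)$. Klein's $j$-function is $j(z)=E_4(z)^3/\Delta(z)=q^{ -1}+744+\sum_{n\ge1}c(n)q^n$, where $E_4$ is the normalized weight $4$ Eisenstein series and $\Delta(z)=q\prod_{n\ge1}(1-q^n)^{24}$. For $N\in\{2,4\}$ the Fricke hauptmodul is $$j_N^+(z)=\left(\frac{\eta(z)}{\eta(Nz)}\right)^{24/(N-1)}+\frac{24}{N-1}+N^{12/(N-1)}\left(\frac{\eta(Nz)}{\eta(z)}\right)^{24/(N-1)},$$ so $j_2^+=(\eta(z)/\eta(2z))^{24}+24+2^{12}(\eta(2z)/\eta(z))^{24}$ and $j_4^+=(\eta(z)/\eta(4z))^{8}+8+4^{4}(\eta(4z)/\eta(z))^{8}$. These have $q$-expansions with integer coefficients; $c_N^+(n)$ is the coefficient of $q^n$ in $j_N^+(z)$. -}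

module Defs where

open import Data.Bool using (if_then_else_)
open import Data.Nat as ℕ using (ℕ; zero; suc; _∸_; NonZero; _≡ᵇ_)
open import Data.Nat.DivMod using (_/_)
open import Data.Nat.Divisibility using (_∣?_)
open import Data.Integer using (ℤ; +_; -[1+_]; 0ℤ; 1ℤ; _+_; _-_; _*_; -_)
open import Data.List using (List; []; _∷_; map; upTo; foldr; _++_; [_])
open import Relation.Nullary using (yes; no)

-- Formal power series in q with integer coefficients: n ↦ coefficient of q^n.
PS : Set
PS = ℕ → ℤ

sumℤ : List ℤ → ℤ
sumℤ = foldr _+_ 0ℤ

Σ≤ : ℕ → (ℕ → ℤ) → ℤ
Σ≤ n f = sumℤ (map f (upTo (suc n)))

mono : ℕ → PS
mono k n = if k ≡ᵇ n then 1ℤ else 0ℤ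

one : PS
one = mono 0

add : PS → PS → PS
add f g n = f n + g n

scale : ℤ → PS → PS
scale a f n = a * f n

mul : PS → PS → PS
mul f g n = Σ≤ n (λ k → f k * g (n ∸ k))

pow : PS → ℕ → PS
pow f zero = one
pow f (suc k) = mul f (pow f k)

-- substitution q ↦ q^N
sub : (N : ℕ) .{{_ : NonZero N}} → PS → PS
sub N f n with N ∣? n
... | yes _ = f (n / N)
... | no _ = 0ℤ

Pfin : ℕ → PS
Pfin zero = one
Pfin (suc k) = mul (Pfin k) (λ n → mono 0 n - mono (suc k) n)

-- P(q) = ∏_{n≥1} (1 - q^n); its q^m-coefficient only involves factors with n ≤ m
P : PS
P m = Pfin m m

nth : ℕ → List ℤ → ℤ
nth _ [] = 0ℤ
nth zero (x ∷ _) = x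
nth (suc i) (_ ∷ xs) = nth i xs

-- coefficients 0..n of the reciprocal 1/f of a series f with f 0 = 1,
-- via  g 0 = 1,  g m = - Σ_{k=1}^{m} f k * g (m - k)
invTable : PS → ℕ → List ℤ
invTable f zero = [ 1ℤ ]
invTable f (suc n) =
  invTable f n ++ [ - Σ≤ n (λ i → f (suc i) * nth (n ∸ i) (invTable f n)) ]

-- reciprocal series (used only for series with constant term 1)
inv : PS → PS
inv f n = nth n (invTable f n)

σ₃ : ℕ → ℕ
σ₃ n = foldr ℕ._+_ 0 (map term (upTo (suc n)))
  where
  term : ℕ → ℕ
  term d with d ∣? n | d
  ... | yes _ | zero = 0
  ... | yes _ | suc e = suc e ℕ.* suc e ℕ.* suc e
  ... | no _ | _ = 0

E4 : PS
E4 zero = 1ℤ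
E4 (suc m) = + (240 ℕ.* σ₃ (suc m))

-- q·j = E₄³ / ∏(1-qⁿ)²⁴   (since Δ = q ∏(1-qⁿ)²⁴)
qj : PS
qj = mul (pow E4 3) (inv (pow P 24))

-- q·j₂⁺ :  (η(z)/η(2z))²⁴ = q⁻¹ P(q)²⁴/P(q²)²⁴
qj2 : PS
qj2 = add (mul (pow P 24) (inv (pow (sub 2 P) 24)))
          (add (scale (+ 24) (mono 1))
               (scale (+ 4096) (mul (mono 2) (mul (pow (sub 2 P) 24) (inv (pow P 24))))))

-- q·j₄⁺ :  (η(z)/η(4z))⁸ = q⁻¹ P(q)⁸/P(q⁴)⁸
qj4 : PS
qj4 = add (mul (pow P 8) (inv (pow (sub 4 P) 8)))
          (add (scale (+ 8) (mono 1))
               (scale (+ 256) (mul (mono 2) (mul (pow (sub 4 P) 8) (inv (pow P 8))))))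

-- coefficient of qⁿ (n ∈ ℤ) of the Laurent series q⁻¹·f
coeffL : PS → ℤ → ℤ
coeffL f (+ n) = f (suc n)
coeffL f -[1+ zero ] = f 0
coeffL f -[1+ suc _ ] = 0ℤ

c : ℤ → ℤ
c = coeffL qj

c2⁺ : ℤ → ℤ
c2⁺ = coeffL qj2

c4⁺ : ℤ → ℤ
c4⁺ = coeffL qj4

module Submission where

-- Write P = ∏ (1 - qⁿ).  Modulo 2 the correction terms of j₂⁺, j₄⁺ have even
-- coefficients and E₄ ≡ 1, so the three series q j, q j₂⁺, q j₄⁺ are congruent to
-- 1/P²⁴, P²⁴/P(q²)²⁴ and P⁸/P(q⁴)⁸.  Frobenius, f(q)² ≡ f(q²) (mod 2), gives
-- P²⁴·P²⁴ ≡ P(q²)²⁴ and P²⁴·P⁸ = P³² ≡ P(q⁴)⁸, and a cancellation law for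
-- reciprocals (u w ≡ v ⇒ w/v ≡ 1/u) turns these into P²⁴/P(q²)²⁴ ≡ 1/P²⁴ ≡ P⁸/P(q⁴)⁸.

open import Defs
open import Data.Integer using (ℤ; +_; -[1+_]; _-_)
open import Data.Integer.Divisibility using (_∣_)
open import Data.Product using (_×_; _,_)

open import Function using (_∘_)
open import Data.Nat as ℕ using (ℕ; zero; suc; _∸_; z≤n; s≤s; NonZero)
open import Data.Nat.Properties as ℕ using ()
open import Data.Nat.DivMod as ℕ using ()
open import Data.Nat.Divisibility as ℕ using (_∣?_; divides)
open import Data.Integer as ℤ using (0ℤ; 1ℤ; _+_; _*_; -_)
open import Data.Integer.Properties as ℤ using ()
open import Data.Integer.DivMod as ℤ using ()
open import Data.Integer.Tactic.RingSolver using (solve-∀)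
import Data.Nat.Tactic.RingSolver as ℕ-Solver
import Data.Integer.Divisibility.Signed as Signed
open import Data.List using (List; []; _∷_; map; applyUpTo; _++_; [_]; length)
open import Data.List.Properties using (length-++)
open import Data.Sum using (inj₁; inj₂)
open import Data.Empty using (⊥-elim)
open import Relation.Nullary using (¬_; Dec; yes; no)
open import Relation.Binary.PropositionalEquality
  using (_≡_; _≗_; refl; sym; trans; cong; cong₂; subst; subst₂; module ≡-Reasoning)
open import Relation.Binary.Structures using (IsEquivalence)
open import Algebra.Bundles using (CommutativeMonoid)
open import Algebra.Structures.Biased using (isCommutativeMonoidˡ)
open import Level using (0ℓ)
import Relation.Binary.Reasoning.Setoid

S : ℕ → (ℕ → ℤ) → ℤ
S zero    h = 0ℤ
S (suc n) h = h 0 + S n (h ∘ suc)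

sum-applyUpTo : ∀ n (g : ℕ → ℕ) (h : ℕ → ℤ) →
                sumℤ (map h (applyUpTo g n)) ≡ S n (h ∘ g)
sum-applyUpTo zero    g h = refl
sum-applyUpTo (suc n) g h = cong (_+_ (h (g 0))) (sum-applyUpTo n (g ∘ suc) h)

Σ≤≡S : ∀ n h → Σ≤ n h ≡ S (suc n) h
Σ≤≡S n h = sum-applyUpTo (suc n) (λ i → i) h

S-cong : ∀ n {h h′ : ℕ → ℤ} → (∀ i → i ℕ.< n → h i ≡ h′ i) → S n h ≡ S n h′
S-cong zero    eq = refl
S-cong (suc n) eq = cong₂ _+_ (eq 0 (s≤s z≤n)) (S-cong n (λ i i<n → eq (suc i) (s≤s i<n)))

S-+ : ∀ n h h′ → S n (λ i → h i + h′ i) ≡ S n h + S n h′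
S-+ zero    h h′ = refl
S-+ (suc n) h h′ = trans (cong (_+_ (h 0 + h′ 0)) (S-+ n (h ∘ suc) (h′ ∘ suc)))
                         (swap-middle (h 0) (h′ 0) _ _)
  where
  swap-middle : ∀ a b c d → (a + b) + (c + d) ≡ (a + c) + (b + d)
  swap-middle = solve-∀

S-*ˡ : ∀ n a h → S n (λ i → a * h i) ≡ a * S n h
S-*ˡ zero    a h = sym (ℤ.*-zeroʳ a)
S-*ˡ (suc n) a h = trans (cong (_+_ (a * h 0)) (S-*ˡ n a (h ∘ suc)))
                         (sym (ℤ.*-distribˡ-+ a (h 0) _))

S-last : ∀ n h → S (suc n) h ≡ S n h + h n
S-last zero    h = trans (ℤ.+-identityʳ (h 0)) (sym (ℤ.+-identityˡ (h 0)))
S-last (suc n) h = trans (cong (_+_ (h 0)) (S-last n (h ∘ suc))) (sym (ℤ.+-assoc (h 0) _ _))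

S-reverse : ∀ n h → S n h ≡ S n (λ i → h (n ∸ suc i))
S-reverse zero    h = refl
S-reverse (suc n) h = begin
  h 0 + S n (h ∘ suc)                         ≡⟨ cong (_+_ (h 0)) (S-reverse n (h ∘ suc)) ⟩
  h 0 + S n (λ i → h (suc (n ∸ suc i)))       ≡⟨ ℤ.+-comm (h 0) _ ⟩
  S n (λ i → h (suc (n ∸ suc i))) + h 0       ≡⟨ cong₂ _+_ (S-cong n (λ i i<n → cong h (sym (ℕ.+-∸-assoc 1 i<n))))
                                                             (cong h (sym (ℕ.n∸n≡0 n))) ⟩
  S n (λ i → h (n ∸ i)) + h (n ∸ n)           ≡⟨ S-last n (λ i → h (n ∸ i)) ⟨
  S (suc n) (λ i → h (n ∸ i))                 ∎
  where open ≡-Reasoning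

-- The Cauchy product, read off recursively: a series f is f 0 + q · shift f.

shift : PS → PS
shift f n = f (suc n)

mul≡S : ∀ f g n → mul f g n ≡ S (suc n) (λ k → f k * g (n ∸ k))
mul≡S f g n = Σ≤≡S n (λ k → f k * g (n ∸ k))

mul-zero : ∀ f g → mul f g 0 ≡ f 0 * g 0
mul-zero f g = ℤ.+-identityʳ (f 0 * g 0)

mul-suc : ∀ f g n → mul f g (suc n) ≡ f 0 * g (suc n) + mul (shift f) g n
mul-suc f g n = trans (mul≡S f g (suc n)) (cong (_+_ (f 0 * g (suc n))) (sym (mul≡S (shift f) g n)))

mul-linearˡ : ∀ a b c x h → (∀ k → a k ≡ x * b k + c k) →
              ∀ n → mul a h n ≡ x * mul b h n + mul c h n
mul-linearˡ a b c x h a≡ n = begin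
  mul a h n                                           ≡⟨ mul≡S a h n ⟩
  S (suc n) (λ k → a k * h (n ∸ k))                   ≡⟨ S-cong (suc n) (λ k _ → expand k) ⟩
  S (suc n) (λ k → x * (b k * h (n ∸ k)) + c k * h (n ∸ k))
    ≡⟨ S-+ (suc n) (λ k → x * (b k * h (n ∸ k))) (λ k → c k * h (n ∸ k)) ⟩
  S (suc n) (λ k → x * (b k * h (n ∸ k))) + S (suc n) (λ k → c k * h (n ∸ k))
    ≡⟨ cong₂ _+_ (S-*ˡ (suc n) x (λ k → b k * h (n ∸ k))) refl ⟩
  x * S (suc n) (λ k → b k * h (n ∸ k)) + S (suc n) (λ k → c k * h (n ∸ k))
    ≡⟨ cong₂ (λ u v → x * u + v) (mul≡S b h n) (mul≡S c h n) ⟨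
  x * mul b h n + mul c h n                           ∎
  where
  open ≡-Reasoning
  distrib : ∀ x b c y → (x * b + c) * y ≡ x * (b * y) + c * y
  distrib = solve-∀
  expand : ∀ k → a k * h (n ∸ k) ≡ x * (b k * h (n ∸ k)) + c k * h (n ∸ k)
  expand k = trans (cong (_* h (n ∸ k)) (a≡ k)) (distrib x (b k) (c k) (h (n ∸ k)))

-- Associativity, by induction on the index: both sides satisfy the same recursion.
mul-assoc : ∀ f g h → mul (mul f g) h ≗ mul f (mul g h)
mul-assoc f g h zero = begin
  mul (mul f g) h 0        ≡⟨ trans (mul-zero (mul f g) h) (cong (_* h 0) (mul-zero f g)) ⟩
  (f 0 * g 0) * h 0        ≡⟨ ℤ.*-assoc (f 0) (g 0) (h 0) ⟩
  f 0 * (g 0 * h 0)        ≡⟨ trans (mul-zero f (mul g h)) (cong (f 0 *_) (mul-zero g h)) ⟨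
  mul f (mul g h) 0        ∎
  where open ≡-Reasoning
mul-assoc f g h (suc n) = begin
  mul (mul f g) h (suc n)
    ≡⟨ mul-suc (mul f g) h n ⟩
  mul f g 0 * h (suc n) + mul (shift (mul f g)) h n
    ≡⟨ cong₂ _+_ (cong (_* h (suc n)) (mul-zero f g))
                 (mul-linearˡ _ (shift g) (mul (shift f) g) (f 0) h (mul-suc f g) n) ⟩
  (f 0 * g 0) * h (suc n) + (f 0 * mul (shift g) h n + mul (mul (shift f) g) h n)
    ≡⟨ cong (λ t → (f 0 * g 0) * h (suc n) + (f 0 * mul (shift g) h n + t)) (mul-assoc (shift f) g h n) ⟩
  (f 0 * g 0) * h (suc n) + (f 0 * mul (shift g) h n + mul (shift f) (mul g h) n)
    ≡⟨ regroup (f 0) (g 0) (h (suc n)) _ _ ⟩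
  f 0 * (g 0 * h (suc n) + mul (shift g) h n) + mul (shift f) (mul g h) n
    ≡⟨ cong (λ t → f 0 * t + mul (shift f) (mul g h) n) (mul-suc g h n) ⟨
  f 0 * mul g h (suc n) + mul (shift f) (mul g h) n
    ≡⟨ mul-suc f (mul g h) n ⟨
  mul f (mul g h) (suc n) ∎
  where
  open ≡-Reasoning
  regroup : ∀ a b c u v → (a * b) * c + (a * u + v) ≡ a * (b * c + u) + v
  regroup = solve-∀

-- Commutativity: reverse the order of summation.
mul-comm : ∀ f g → mul f g ≗ mul g f
mul-comm f g n = begin
  mul f g n                                     ≡⟨ mul≡S f g n ⟩
  S (suc n) (λ k → f k * g (n ∸ k))             ≡⟨ S-reverse (suc n) (λ k → f k * g (n ∸ k)) ⟩
  S (suc n) (λ i → f (n ∸ i) * g (n ∸ (n ∸ i))) ≡⟨ S-cong (suc n) swap ⟩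
  S (suc n) (λ k → g k * f (n ∸ k))             ≡⟨ mul≡S g f n ⟨
  mul g f n                                     ∎
  where
  open ≡-Reasoning
  swap : ∀ i → i ℕ.< suc n → f (n ∸ i) * g (n ∸ (n ∸ i)) ≡ g i * f (n ∸ i)
  swap i (s≤s i≤n) = trans (cong (λ j → f (n ∸ i) * g j) (ℕ.m∸[m∸n]≡n i≤n)) (ℤ.*-comm (f (n ∸ i)) (g i))

mul-zeroˡ : ∀ g → mul (λ _ → 0ℤ) g ≗ (λ _ → 0ℤ)
mul-zeroˡ g zero    = mul-zero (λ _ → 0ℤ) g
mul-zeroˡ g (suc n) = trans (mul-suc (λ _ → 0ℤ) g n) (trans (ℤ.+-identityˡ _) (mul-zeroˡ g n))

mul-identityˡ : ∀ f → mul one f ≗ f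
mul-identityˡ f zero    = trans (mul-zero one f) (ℤ.*-identityˡ (f 0))
mul-identityˡ f (suc n) = begin
  mul one f (suc n)                              ≡⟨ mul-suc one f n ⟩
  1ℤ * f (suc n) + mul (λ _ → 0ℤ) f n            ≡⟨ cong₂ _+_ (ℤ.*-identityˡ (f (suc n))) (mul-zeroˡ f n) ⟩
  f (suc n) + 0ℤ                                 ≡⟨ ℤ.+-identityʳ (f (suc n)) ⟩
  f (suc n)                                      ∎
  where open ≡-Reasoning

nth-++ˡ : ∀ i (xs ys : List ℤ) → i ℕ.< length xs → nth i (xs ++ ys) ≡ nth i xs
nth-++ˡ zero    (x ∷ xs) ys _         = refl
nth-++ˡ (suc i) (x ∷ xs) ys (s≤s i<n) = nth-++ˡ i xs ys i<n

nth-length : ∀ (xs : List ℤ) y → nth (length xs) (xs ++ [ y ]) ≡ y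
nth-length []       y = refl
nth-length (x ∷ xs) y = nth-length xs y

length-invTable : ∀ f n → length (invTable f n) ≡ suc n
length-invTable f zero    = refl
length-invTable f (suc n) =
  trans (length-++ (invTable f n)) (trans (ℕ.+-comm _ 1) (cong suc (length-invTable f n)))

invTable-stable : ∀ f n i → i ℕ.≤ n → nth i (invTable f n) ≡ inv f i
invTable-stable f zero    zero z≤n = refl
invTable-stable f (suc n) i i≤1+n with ℕ.m≤n⇒m<n∨m≡n i≤1+n
... | inj₂ refl      = refl
... | inj₁ (s≤s i≤n) =
  trans (nth-++ˡ i (invTable f n) _ (subst (i ℕ.<_) (sym (length-invTable f n)) (s≤s i≤n)))
        (invTable-stable f n i i≤n)

inv-suc : ∀ f n → inv f (suc n) ≡ - mul (shift f) (inv f) n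
inv-suc f n = begin
  nth (suc n) (invTable f n ++ [ next ])              ≡⟨ cong (λ i → nth i (invTable f n ++ [ next ])) (length-invTable f n) ⟨
  nth (length (invTable f n)) (invTable f n ++ [ next ]) ≡⟨ nth-length (invTable f n) next ⟩
  next                                                 ≡⟨ cong -_ (Σ≤-cong (λ i i≤n → cong (f (suc i) *_) (invTable-stable f n (n ∸ i) (ℕ.m∸n≤m n i)))) ⟩
  - mul (shift f) (inv f) n                            ∎
  where
  open ≡-Reasoning
  next : ℤ
  next = - Σ≤ n (λ i → f (suc i) * nth (n ∸ i) (invTable f n))
  Σ≤-cong : ∀ {h h′ : ℕ → ℤ} → (∀ i → i ℕ.≤ n → h i ≡ h′ i) → Σ≤ n h ≡ Σ≤ n h′
  Σ≤-cong {h} {h′} eq = trans (Σ≤≡S n h) (trans (S-cong (suc n) (λ i i<1+n → eq i (ℕ.≤-pred i<1+n))) (sym (Σ≤≡S n h′)))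

mul-inverseʳ : ∀ f → f 0 ≡ 1ℤ → mul f (inv f) ≗ one
mul-inverseʳ f f₀≡1 zero    = trans (mul-zero f (inv f)) (cong (_* 1ℤ) f₀≡1)
mul-inverseʳ f f₀≡1 (suc n) = begin
  mul f (inv f) (suc n)                                       ≡⟨ mul-suc f (inv f) n ⟩
  f 0 * inv f (suc n) + mul (shift f) (inv f) n               ≡⟨ cong₂ (λ a b → a * b + mul (shift f) (inv f) n) f₀≡1 (inv-suc f n) ⟩
  1ℤ * (- mul (shift f) (inv f) n) + mul (shift f) (inv f) n  ≡⟨ cancel (mul (shift f) (inv f) n) ⟩
  0ℤ                                                          ∎
  where
  open ≡-Reasoning
  cancel : ∀ y → 1ℤ * (- y) + y ≡ 0ℤ
  cancel = solve-∀

sub-multiple : ∀ N .{{_ : NonZero N}} f k → sub N f (k ℕ.* N) ≡ f k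
sub-multiple N f k with N ∣? k ℕ.* N
... | yes _  = cong f (ℕ.m*n/n≡m k N)
... | no N∤ = ⊥-elim (N∤ (ℕ.n∣m*n k))

sub-nonmultiple : ∀ N .{{_ : NonZero N}} f n → ¬ (N ℕ.∣ n) → sub N f n ≡ 0ℤ
sub-nonmultiple N f n N∤n with N ∣? n
... | yes N∣n = ⊥-elim (N∤n N∣n)
... | no _    = refl

sub-shift : ∀ N .{{_ : NonZero N}} f m → sub N f (N ℕ.+ m) ≡ sub N (shift f) m
sub-shift N f m = by-cases (N ∣? m)
  where
  open ≡-Reasoning
  by-cases : Dec (N ℕ.∣ m) → sub N f (N ℕ.+ m) ≡ sub N (shift f) m
  by-cases (yes (divides k m≡kN)) = begin
    sub N f (N ℕ.+ m)          ≡⟨ cong (λ i → sub N f (N ℕ.+ i)) m≡kN ⟩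
    sub N f (suc k ℕ.* N)      ≡⟨ sub-multiple N f (suc k) ⟩
    f (suc k)                  ≡⟨ sub-multiple N (shift f) k ⟨
    sub N (shift f) (k ℕ.* N)  ≡⟨ cong (sub N (shift f)) m≡kN ⟨
    sub N (shift f) m          ∎
  by-cases (no N∤m) =
    trans (sub-nonmultiple N f (N ℕ.+ m) (λ N∣N+m → N∤m (ℕ.∣m+n∣m⇒∣n N∣N+m ℕ.∣-refl)))
          (sym (sub-nonmultiple N (shift f) m N∤m))

sub-sub : ∀ M N .{{_ : NonZero M}} .{{_ : NonZero N}} f →
          sub M (sub N f) ≗ sub (M ℕ.* N) {{ℕ.m*n≢0 M N}} f
sub-sub M N f n = by-cases (M ℕ.* N ∣? n)
  where
  instance _ = ℕ.m*n≢0 M N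
  open ≡-Reasoning
  reorder : ∀ k → k ℕ.* (M ℕ.* N) ≡ (k ℕ.* N) ℕ.* M
  reorder k = trans (cong (k ℕ.*_) (ℕ.*-comm M N)) (sym (ℕ.*-assoc k N M))
  lhs-vanishes : ¬ (M ℕ.* N ℕ.∣ n) → Dec (M ℕ.∣ n) → sub M (sub N f) n ≡ 0ℤ
  lhs-vanishes MN∤n (no M∤n) = sub-nonmultiple M (sub N f) n M∤n
  lhs-vanishes MN∤n (yes (divides j n≡jM)) = begin
    sub M (sub N f) n          ≡⟨ cong (sub M (sub N f)) n≡jM ⟩
    sub M (sub N f) (j ℕ.* M)  ≡⟨ sub-multiple M (sub N f) j ⟩
    sub N f j                  ≡⟨ sub-nonmultiple N f j N∤j ⟩
    0ℤ                         ∎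
    where
    N∤j : ¬ (N ℕ.∣ j)
    N∤j (divides i j≡iN) = MN∤n (divides i (trans n≡jM (trans (cong (ℕ._* M) j≡iN) (sym (reorder i)))))
  by-cases : Dec (M ℕ.* N ℕ.∣ n) → sub M (sub N f) n ≡ sub (M ℕ.* N) f n
  by-cases (yes (divides k n≡kMN)) = begin
    sub M (sub N f) n                    ≡⟨ cong (sub M (sub N f)) (trans n≡kMN (reorder k)) ⟩
    sub M (sub N f) ((k ℕ.* N) ℕ.* M)    ≡⟨ sub-multiple M (sub N f) (k ℕ.* N) ⟩
    sub N f (k ℕ.* N)                    ≡⟨ sub-multiple N f k ⟩
    f k                                  ≡⟨ sub-multiple (M ℕ.* N) f k ⟨
    sub (M ℕ.* N) f (k ℕ.* (M ℕ.* N))    ≡⟨ cong (sub (M ℕ.* N) f) n≡kMN ⟨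
    sub (M ℕ.* N) f n                    ∎
  by-cases (no MN∤n) =
    trans (lhs-vanishes MN∤n (M ∣? n)) (sym (sub-nonmultiple (M ℕ.* N) f n MN∤n))

-- Congruence of integers modulo d: d divides the difference (a record, so
-- that a, b and d can be inferred from a congruence).

infix 4 _≡_mod_
record _≡_mod_ (a b d : ℤ) : Set where
  constructor congruent
  field difference : d Signed.∣ (a - b)
open _≡_mod_ public

module _ {d : ℤ} where

  ≡-mod-refl : ∀ {a} → a ≡ a mod d
  ≡-mod-refl {a} = congruent (Signed.divides 0ℤ (ℤ.+-inverseʳ a))

  ≡-mod-reflexive : ∀ {a b} → a ≡ b → a ≡ b mod d
  ≡-mod-reflexive refl = ≡-mod-refl

  ≡-mod-sym : ∀ {a b} → a ≡ b mod d → b ≡ a mod d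
  ≡-mod-sym {a} {b} (congruent d∣a-b) = congruent (subst (d Signed.∣_) (negate a b) (Signed.∣m⇒∣-m d∣a-b))
    where
    negate : ∀ a b → - (a - b) ≡ b - a
    negate = solve-∀

  ≡-mod-trans : ∀ {a b c} → a ≡ b mod d → b ≡ c mod d → a ≡ c mod d
  ≡-mod-trans {a} {b} {c} (congruent d∣a-b) (congruent d∣b-c) =
    congruent (subst (d Signed.∣_) (telescope a b c) (Signed.∣m∣n⇒∣m+n d∣a-b d∣b-c))
    where
    telescope : ∀ a b c → (a - b) + (b - c) ≡ a - c
    telescope = solve-∀

  +-cong-mod : ∀ {a b a′ b′} → a ≡ a′ mod d → b ≡ b′ mod d → a + b ≡ a′ + b′ mod d
  +-cong-mod {a} {b} {a′} {b′} (congruent d∣a) (congruent d∣b) =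
    congruent (subst (d Signed.∣_) (regroup a b a′ b′) (Signed.∣m∣n⇒∣m+n d∣a d∣b))
    where
    regroup : ∀ a b a′ b′ → (a - a′) + (b - b′) ≡ (a + b) - (a′ + b′)
    regroup = solve-∀

  *-cong-mod : ∀ {a b a′ b′} → a ≡ a′ mod d → b ≡ b′ mod d → a * b ≡ a′ * b′ mod d
  *-cong-mod {a} {b} {a′} {b′} (congruent d∣a) (congruent d∣b) =
    congruent (subst (d Signed.∣_) (regroup a b a′ b′)
                     (Signed.∣m∣n⇒∣m+n (Signed.∣m⇒∣m*n b d∣a) (Signed.∣n⇒∣m*n a′ d∣b)))
    where
    regroup : ∀ a b a′ b′ → (a - a′) * b + a′ * (b - b′) ≡ a * b - a′ * b′
    regroup = solve-∀

  multiple≡0-mod : ∀ {m} → d Signed.∣ m → m ≡ 0ℤ mod d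
  multiple≡0-mod {m} d∣m = congruent (subst (d Signed.∣_) (sym (ℤ.+-identityʳ m)) d∣m)

  +-multiple-mod : ∀ a {m} → d Signed.∣ m → a + m ≡ a mod d
  +-multiple-mod a {m} d∣m =
    subst (λ x → a + m ≡ x mod d) (ℤ.+-identityʳ a) (+-cong-mod (≡-mod-refl {a}) (multiple≡0-mod d∣m))

  ≡-mod-resp : ∀ {a b a′ b′} → a ≡ a′ → b ≡ b′ → a ≡ b mod d → a′ ≡ b′ mod d
  ≡-mod-resp = subst₂ (λ x y → x ≡ y mod d)

infix 4 _≈_mod_
record _≈_mod_ (f g : PS) (d : ℤ) : Set where
  constructor coeffwise
  field coeff : ∀ n → f n ≡ g n mod d
open _≈_mod_ public

module _ {d : ℤ} where

  ≗⇒≈ : ∀ {f g} → f ≗ g → f ≈ g mod d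
  ≗⇒≈ f≗g = coeffwise (λ n → ≡-mod-reflexive (f≗g n))

  ≈-isEquivalence : IsEquivalence (λ f g → f ≈ g mod d)
  ≈-isEquivalence = record
    { refl  = coeffwise (λ n → ≡-mod-refl)
    ; sym   = λ f≈g → coeffwise (λ n → ≡-mod-sym (coeff f≈g n))
    ; trans = λ f≈g g≈h → coeffwise (λ n → ≡-mod-trans (coeff f≈g n) (coeff g≈h n))
    }

  mul-cong-coeff : ∀ {f f′ g g′} → (∀ n → f n ≡ f′ n mod d) → (∀ n → g n ≡ g′ n mod d) →
                   ∀ n → mul f g n ≡ mul f′ g′ n mod d
  mul-cong-coeff f≡f′ g≡g′ zero    = +-cong-mod (*-cong-mod (f≡f′ 0) (g≡g′ 0)) ≡-mod-refl
  mul-cong-coeff {f} {f′} {g} {g′} f≡f′ g≡g′ (suc n) =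
    ≡-mod-resp (sym (mul-suc f g n)) (sym (mul-suc f′ g′ n))
      (+-cong-mod (*-cong-mod (f≡f′ 0) (g≡g′ (suc n))) (mul-cong-coeff (f≡f′ ∘ suc) g≡g′ n))

  mul-cong : ∀ {f f′ g g′} → f ≈ f′ mod d → g ≈ g′ mod d → mul f g ≈ mul f′ g′ mod d
  mul-cong f≈f′ g≈g′ = coeffwise (mul-cong-coeff (coeff f≈f′) (coeff g≈g′))

seriesMonoid : ℤ → CommutativeMonoid 0ℓ 0ℓ
seriesMonoid d = record
  { Carrier             = PS
  ; _≈_                 = λ f g → f ≈ g mod d
  ; _∙_                 = mul
  ; ε                   = one
  ; isCommutativeMonoid = isCommutativeMonoidˡ record
    { isSemigroup = record
      { isMagma = record { isEquivalence = ≈-isEquivalence ; ∙-cong = mul-cong }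
      ; assoc   = λ f g h → ≗⇒≈ (mul-assoc f g h)
      }
    ; identityˡ = λ f → ≗⇒≈ (mul-identityˡ f)
    ; comm      = λ f g → ≗⇒≈ (mul-comm f g)
    }
  }

module ≈-Reasoning (d : ℤ) =
  Relation.Binary.Reasoning.Setoid (CommutativeMonoid.setoid (seriesMonoid d))

module _ {d : ℤ} where

  open CommutativeMonoid (seriesMonoid d)
    using (assoc; comm; identityˡ; identityʳ; ∙-congˡ; ∙-congʳ; monoid)
    renaming (refl to ≈-refl; trans to ≈-trans)
  open import Algebra.Properties.Monoid.Mult monoid using (×-congʳ; ×-homo-+)
    renaming (_×_ to _·_)
  open import Algebra.Properties.CommutativeMonoid.Mult (seriesMonoid d) using (×-distrib-+)
  open ≈-Reasoning d

  pow≡· : ∀ f k → pow f k ≡ k · f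
  pow≡· f zero    = refl
  pow≡· f (suc k) = cong (mul f) (pow≡· f k)

  pow-cong : ∀ {f g} k → f ≈ g mod d → pow f k ≈ pow g k mod d
  pow-cong {f} {g} k f≈g rewrite pow≡· f k | pow≡· g k = ×-congʳ k f≈g

  pow-one : ∀ k → pow one k ≈ one mod d
  pow-one zero    = ≈-refl
  pow-one (suc k) = ≈-trans (identityˡ (pow one k)) (pow-one k)

  pow-+ : ∀ f m n → pow f (m ℕ.+ n) ≈ mul (pow f m) (pow f n) mod d
  pow-+ f m n rewrite pow≡· f (m ℕ.+ n) | pow≡· f m | pow≡· f n = ×-homo-+ f m n

  pow-mul : ∀ f g k → pow (mul f g) k ≈ mul (pow f k) (pow g k) mod d
  pow-mul f g k rewrite pow≡· (mul f g) k | pow≡· f k | pow≡· g k = ×-distrib-+ f g k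

  reciprocal-transfer : ∀ u v w → u 0 ≡ 1ℤ → v 0 ≡ 1ℤ →
                        mul u w ≈ v mod d → mul w (inv v) ≈ inv u mod d
  reciprocal-transfer u v w u₀≡1 v₀≡1 uw≈v = begin
    mul w (inv v)                           ≈⟨ identityˡ (mul w (inv v)) ⟨
    mul one (mul w (inv v))                 ≈⟨ ∙-congʳ (≗⇒≈ (mul-inverseʳ u u₀≡1)) ⟨
    mul (mul u (inv u)) (mul w (inv v))     ≈⟨ ∙-congʳ (comm u (inv u)) ⟩
    mul (mul (inv u) u) (mul w (inv v))     ≈⟨ assoc (inv u) u (mul w (inv v)) ⟩
    mul (inv u) (mul u (mul w (inv v)))     ≈⟨ ∙-congˡ {inv u} (assoc u w (inv v)) ⟨
    mul (inv u) (mul (mul u w) (inv v))     ≈⟨ ∙-congˡ {inv u} (∙-congʳ uw≈v) ⟩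
    mul (inv u) (mul v (inv v))             ≈⟨ ∙-congˡ {inv u} (≗⇒≈ (mul-inverseʳ v v₀≡1)) ⟩
    mul (inv u) one                         ≈⟨ identityʳ (inv u) ⟩
    inv u                                   ∎

-- Every integer is congruent to its square: write x = r + 2q with r ∈ {0, 1}.
square-mod-2 : ∀ x → x * x ≡ x mod + 2
square-mod-2 x = subst (λ y → y * y ≡ y mod + 2) (sym (ℤ.a≡a%ℕn+[a/ℕn]*n x 2))
                       (by-remainder (x ℤ.%ℕ 2) (ℤ.n%ℕd<d x 2))
  where
  q : ℤ
  q = x ℤ./ℕ 2
  even-part : ∀ q → (+ 0 + q * + 2) * (+ 0 + q * + 2) - (+ 0 + q * + 2) ≡ (q * q * + 2 - q) * + 2
  even-part = solve-∀
  odd-part : ∀ q → (+ 1 + q * + 2) * (+ 1 + q * + 2) - (+ 1 + q * + 2) ≡ (q + q * q * + 2) * + 2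
  odd-part = solve-∀
  by-remainder : ∀ r → r ℕ.< 2 → (+ r + q * + 2) * (+ r + q * + 2) ≡ + r + q * + 2 mod + 2
  by-remainder 0 _ = congruent (Signed.divides (q * q * + 2 - q) (even-part q))
  by-remainder 1 _ = congruent (Signed.divides (q + q * q * + 2) (odd-part q))
  by-remainder (suc (suc _)) (s≤s (s≤s ()))

-- Squaring a series: the cross terms f₀ fₙ₊₂ appear twice.
square-step : ∀ f m → mul f f (suc (suc m)) ≡ mul (shift f) (shift f) m + (f 0 * f (suc (suc m))) * + 2
square-step f m = begin
  mul f f (suc (suc m))                                          ≡⟨ mul-suc f f (suc m) ⟩
  a + mul (shift f) f (suc m)                                    ≡⟨ cong (_+_ a) (mul-comm (shift f) f (suc m)) ⟩
  a + mul f (shift f) (suc m)                                    ≡⟨ cong (_+_ a) (mul-suc f (shift f) m) ⟩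
  a + (a + mul (shift f) (shift f) m)                            ≡⟨ double a (mul (shift f) (shift f) m) ⟩
  mul (shift f) (shift f) m + a * + 2                            ∎
  where
  open ≡-Reasoning
  a : ℤ
  a = f 0 * f (suc (suc m))
  double : ∀ a b → a + (a + b) ≡ b + a * + 2
  double = solve-∀

frobenius-coeff : ∀ f n → mul f f n ≡ sub 2 f n mod + 2
frobenius-coeff f zero = ≡-mod-trans (≡-mod-reflexive (mul-zero f f)) (square-mod-2 (f 0))
-- (f²)₁ = f₀f₁ + f₁f₀.
frobenius-coeff f (suc zero) = congruent (Signed.divides (f 0 * f 1) (cross (f 0) (f 1)))
  where
  cross : ∀ a b → a * b + (b * a + 0ℤ) - 0ℤ ≡ (a * b) * + 2
  cross = solve-∀
frobenius-coeff f (suc (suc m)) =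
  ≡-mod-resp (sym (square-step f m)) (sym (sub-shift 2 f m))
    (≡-mod-trans (+-multiple-mod (mul (shift f) (shift f) m) (Signed.divides (f 0 * f (suc (suc m))) refl))
                 (frobenius-coeff (shift f) m))

frobenius : ∀ f → mul f f ≈ sub 2 f mod + 2
frobenius f = coeffwise (frobenius-coeff f)

-- Consequently f^(2k) ≡ f(q²)^k modulo 2.  The exponent n = k + k is passed
-- separately so that instances such as 24 + 8 = 16 + 16 are checked on numerals.
frobenius-pow : ∀ f k n → k ℕ.+ k ≡ n → pow f n ≈ pow (sub 2 f) k mod + 2
frobenius-pow f k .(k ℕ.+ k) refl = begin
  pow f (k ℕ.+ k)                 ≈⟨ pow-+ f k k ⟩
  mul (pow f k) (pow f k)         ≈⟨ pow-mul f f k ⟨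
  pow (mul f f) k                 ≈⟨ pow-cong k (frobenius f) ⟩
  pow (sub 2 f) k                 ∎
  where open ≈-Reasoning (+ 2)

pow-constant : ∀ f → f 0 ≡ 1ℤ → ∀ k → pow f k 0 ≡ 1ℤ
pow-constant f f₀≡1 zero    = refl
pow-constant f f₀≡1 (suc k) = trans (mul-zero f (pow f k)) (cong₂ _*_ f₀≡1 (pow-constant f f₀≡1 k))

drop-multiples : ∀ {d} f a g b h → d Signed.∣ a → d Signed.∣ b →
                 add f (add (scale a g) (scale b h)) ≈ f mod d
drop-multiples f a g b h d∣a d∣b =
  coeffwise (λ n → +-multiple-mod (f n) (Signed.∣m∣n⇒∣m+n (Signed.∣m⇒∣m*n (g n) d∣a) (Signed.∣m⇒∣m*n (h n) d∣b)))

E4≈one : E4 ≈ one mod + 2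
E4≈one = coeffwise E4-coeff
  where
  halve : ∀ s → 240 ℕ.* s ≡ 120 ℕ.* s ℕ.* 2
  halve = ℕ-Solver.solve-∀
  E4-coeff : ∀ n → E4 n ≡ one n mod + 2
  E4-coeff zero    = ≡-mod-refl
  E4-coeff (suc m) = multiple≡0-mod (Signed.divides (+ (120 ℕ.* σ₃ (suc m)))
                       (trans (cong +_ (halve (σ₃ (suc m)))) (ℤ.pos-* (120 ℕ.* σ₃ (suc m)) 2)))

-- q j ≡ 1 / P²⁴ : the numerator E₄³ is ≡ 1.
qj≈ : qj ≈ inv (pow P 24) mod + 2
qj≈ = begin
  mul (pow E4 3) (inv (pow P 24))    ≈⟨ ∙-congʳ {inv (pow P 24)} (pow-cong 3 E4≈one) ⟩
  mul (pow one 3) (inv (pow P 24))   ≈⟨ ∙-congʳ {inv (pow P 24)} (pow-one 3) ⟩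
  mul one (inv (pow P 24))           ≈⟨ identityˡ (inv (pow P 24)) ⟩
  inv (pow P 24)                     ∎
  where
  open ≈-Reasoning (+ 2)
  open CommutativeMonoid (seriesMonoid (+ 2)) using (∙-congʳ; identityˡ)

qj2≈ : qj2 ≈ mul (pow P 24) (inv (pow (sub 2 P) 24)) mod + 2
qj2≈ = drop-multiples _ (+ 24) (mono 1) (+ 4096) _ (Signed.divides (+ 12) refl) (Signed.divides (+ 2048) refl)

qj4≈ : qj4 ≈ mul (pow P 8) (inv (pow (sub 4 P) 8)) mod + 2
qj4≈ = drop-multiples _ (+ 8) (mono 1) (+ 256) _ (Signed.divides (+ 4) refl) (Signed.divides (+ 128) refl)

P²⁴·P²⁴≈ : mul (pow P 24) (pow P 24) ≈ pow (sub 2 P) 24 mod + 2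
P²⁴·P²⁴≈ = begin
  mul (pow P 24) (pow P 24)   ≈⟨ pow-+ P 24 24 ⟨
  pow P (24 ℕ.+ 24)           ≈⟨ frobenius-pow P 24 (24 ℕ.+ 24) refl ⟩
  pow (sub 2 P) 24            ∎
  where open ≈-Reasoning (+ 2)

P²⁴·P⁸≈ : mul (pow P 24) (pow P 8) ≈ pow (sub 4 P) 8 mod + 2
P²⁴·P⁸≈ = begin
  mul (pow P 24) (pow P 8)    ≈⟨ pow-+ P 24 8 ⟨
  pow P (24 ℕ.+ 8)            ≈⟨ frobenius-pow P 16 (24 ℕ.+ 8) refl ⟩
  pow (sub 2 P) 16            ≈⟨ frobenius-pow (sub 2 P) 8 16 refl ⟩
  pow (sub 2 (sub 2 P)) 8     ≈⟨ pow-cong {f = sub 2 (sub 2 P)} {g = sub 4 P} 8 (≗⇒≈ (sub-sub 2 2 P)) ⟩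
  pow (sub 4 P) 8             ∎
  where open ≈-Reasoning (+ 2)

1/P²⁴≈qj2 : inv (pow P 24) ≈ qj2 mod + 2
1/P²⁴≈qj2 = begin
  inv (pow P 24)                                 ≈⟨ reciprocal-transfer (pow P 24) (pow (sub 2 P) 24) (pow P 24)
                                                      (pow-constant P refl 24) (pow-constant (sub 2 P) refl 24) P²⁴·P²⁴≈ ⟨
  mul (pow P 24) (inv (pow (sub 2 P) 24))        ≈⟨ qj2≈ ⟨
  qj2                                            ∎
  where open ≈-Reasoning (+ 2)

1/P²⁴≈qj4 : inv (pow P 24) ≈ qj4 mod + 2
1/P²⁴≈qj4 = begin
  inv (pow P 24)                                 ≈⟨ reciprocal-transfer (pow P 24) (pow (sub 4 P) 8) (pow P 8)
                                                      (pow-constant P refl 24) (pow-constant (sub 4 P) refl 8) P²⁴·P⁸≈ ⟨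
  mul (pow P 8) (inv (pow (sub 4 P) 8))          ≈⟨ qj4≈ ⟨
  qj4                                            ∎
  where open ≈-Reasoning (+ 2)

coeffL-mod : ∀ {d f g} → f ≈ g mod d → ∀ n → d ∣ (coeffL f n - coeffL g n)
coeffL-mod f≈g (+ n)           = Signed.∣⇒∣ᵤ (difference (coeff f≈g (suc n)))
coeffL-mod f≈g -[1+ zero ]     = Signed.∣⇒∣ᵤ (difference (coeff f≈g 0))
coeffL-mod {d} f≈g -[1+ suc _ ] = Signed.∣⇒∣ᵤ (difference (≡-mod-refl {d} {0ℤ}))

theorem2p1 : (n : ℤ) → ((+ 2) ∣ (c n - c2⁺ n)) × ((+ 2) ∣ (c2⁺ n - c4⁺ n))
theorem2p1 n = coeffL-mod qj≈qj2 n , coeffL-mod qj2≈qj4 n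
  where
  open ≈-Reasoning (+ 2)
  qj≈qj2 : qj ≈ qj2 mod + 2
  qj≈qj2 = begin qj ≈⟨ qj≈ ⟩ inv (pow P 24) ≈⟨ 1/P²⁴≈qj2 ⟩ qj2 ∎
  qj2≈qj4 : qj2 ≈ qj4 mod + 2
  qj2≈qj4 = begin qj2 ≈⟨ 1/P²⁴≈qj2 ⟨ inv (pow P 24) ≈⟨ 1/P²⁴≈qj4 ⟩ qj4 ∎
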